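{- The theories $\mathbf{V}\cup\mathbf{KK}$ and $\mathbf{K}\cup\mathbf{KK}$ are not generic.
   Context: Fix a nonempty set of symbols called propositional atoms and a symbol $\mathrm{K}$ which is not a propositional atom. Formulas are defined recursively: every propositional atom is a formula; if $\varphi,\psi$ are formulas then so are $\neg\varphi$, $(\varphi\wedge\psi)$, $(\varphi\vee\psi)$, $(\varphi\rightarrow\psi)$; if $\varphi$ is a formula then so is $\mathrm{K}(\varphi)$. A formula is basic if it is a propositional atom or of the form $\mathrm{K}\varphi$. A theory is a set of formulas. A model is a function assigning a truth value to every basic formula; truth $\mathscr M\models\varphi$ of an arbitrary formula is defined from the values of basic formulas by the classical truth tables (formulas $\mathrm{K}\varphi$ are treated like atoms). $\mathscr M\models T$ means $\mathscr M\models\varphi$ for all $\varphi\in T$; $T\models\varphi$ means every model of $T$ satisfies $\varphi$; $\varphi$ is valid if $\emptyset\models\varphi$. $\mathbf{V}=\{\mathrm{K}\varphi:\varphi\text{ valid}\}$; $\mathbf{K}=\{\mathrm{K}(\varphi\rightarrow\psi)\rightarrow(\mathrm{K}\varphi\rightarrow\mathrm{K}\psi)\}$; $\mathbf{KK}=\{\mathrm{K}\varphi\rightarrow\mathrm{K}\mathrm{K}\varphi\}$ (all formulas of these forms). For a theory $T$ and a set $S$ of propositional atoms, $\mathscr M_{T,S}$ is the model with $\mathscr M_{T,S}\models p$ iff $p\in S$ for atoms $p$, and $\mathscr M_{T,S}\models\mathrm{K}\varphi$ iff $T\models\varphi$. A theory $T$ is generic if for every set $S$ of propositional atoms and every theory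 $T'\supseteq T$, $\mathscr M_{T',S}\models T$. -}

module Defs where

open import Data.Bool using (Bool; true; false; not; _∧_; _∨_)
open import Data.Product using (Σ; _×_; ∃-syntax)
open import Data.Sum using (_⊎_)
open import Relation.Binary.PropositionalEquality using (_≡_)

module Logic (Atom : Set) where

  infixr 5 _⇒_
  infixr 6 _∨ᶠ_
  infixr 7 _∧ᶠ_

  data Formula : Set where
    atom  : Atom → Formula
    ¬ᶠ_   : Formula → Formula
    _∧ᶠ_  : Formula → Formula → Formula
    _∨ᶠ_  : Formula → Formula → Formula
    _⇒_   : Formula → Formula → Formula
    K     : Formula → Formula

  -- A model assigns a truth value to every basic formula:
  -- to every atom p and to every formula of the form K φ.
  record Model : Set where
    field
      atomVal : Atom → Bool
      kVal    : Formula → Bool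
  open Model public

  eval : Model → Formula → Bool
  eval M (atom p) = atomVal M p
  eval M (¬ᶠ φ)   = not (eval M φ)
  eval M (φ ∧ᶠ ψ) = eval M φ ∧ eval M ψ
  eval M (φ ∨ᶠ ψ) = eval M φ ∨ eval M ψ
  eval M (φ ⇒ ψ)  = not (eval M φ) ∨ eval M ψ
  eval M (K φ)    = kVal M φ

  _⊨_ : Model → Formula → Set
  M ⊨ φ = eval M φ ≡ true

  Theory : Set₁
  Theory = Formula → Set

  _⊆_ : Theory → Theory → Set
  T ⊆ T' = ∀ φ → T φ → T' φ

  _∪_ : Theory → Theory → Theory
  (T ∪ T') φ = T φ ⊎ T' φ

  _⊨ᵀ_ : Model → Theory → Set
  M ⊨ᵀ T = ∀ φ → T φ → M ⊨ φ

  _⊩_ : Theory → Formula → Set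
  T ⊩ φ = ∀ (M : Model) → M ⊨ᵀ T → M ⊨ φ

  Valid : Formula → Set
  Valid φ = ∀ (M : Model) → M ⊨ φ

  𝐕 : Theory
  𝐕 ψ = Σ Formula λ φ → (ψ ≡ K φ) × Valid φ

  𝐊 : Theory
  𝐊 χ = Σ Formula λ φ → Σ Formula λ ψ → χ ≡ (K (φ ⇒ ψ) ⇒ (K φ ⇒ K ψ))

  𝐊𝐊 : Theory
  𝐊𝐊 χ = Σ Formula λ φ → χ ≡ (K φ ⇒ K (K φ))

  -- A set S of atoms is given by its characteristic function.
  -- "M is the model M_{T,S}": atoms true exactly on S, and K φ true iff T ⊩ φ.
  -- (This relation determines M uniquely.)
  IsCanonical : Theory → (Atom → Bool) → Model → Set
  IsCanonical T S M =
    (∀ p → atomVal M p ≡ S p) ×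
    (∀ φ → (kVal M φ ≡ true → T ⊩ φ) × (T ⊩ φ → kVal M φ ≡ true))

  Generic : Theory → Set₁
  Generic T = ∀ (S : Atom → Bool) (T' : Theory) → T ⊆ T' →
              ∀ (M : Model) → IsCanonical T' S M → M ⊨ᵀ T

{-# OPTIONS --safe #-}
module Submission where

-- Let A make every atom false and every K φ true, and let N make every atom
-- true and K φ true iff A ⊨ φ.  N satisfies 𝐕, 𝐊 and 𝐊𝐊, so both theories are
-- contained in the complete theory T' = {φ : N ⊨ φ}.  A complete theory has
-- N as its only model up to truth, so M_{T',S} makes K φ true iff N ⊨ φ.  There
-- K p → K K p fails: N ⊨ p, but N ⊭ K p because A ⊭ p.

open import Defs
open import Data.Bool using (Bool; true; false; not)
open import Data.Bool.Properties using (not-injective)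
open import Data.Product using (_×_; _,_)
open import Data.Sum using (inj₁; inj₂)
open import Function using (const)
open import Relation.Nullary using (¬_)
open import Relation.Binary.PropositionalEquality using (_≡_; refl; trans; cong)

module _ {Atom : Set} where
  open Logic Atom

  theoryOf : Model → Theory
  theoryOf N φ = N ⊨ φ

  ⊨ᵀ-∪ : ∀ {M T T'} → M ⊨ᵀ T → M ⊨ᵀ T' → M ⊨ᵀ (T ∪ T')
  ⊨ᵀ-∪ M⊨T _    φ (inj₁ φ∈T)  = M⊨T φ φ∈T
  ⊨ᵀ-∪ _   M⊨T' φ (inj₂ φ∈T') = M⊨T' φ φ∈T'

  theoryOf-complete : ∀ N M → M ⊨ᵀ theoryOf N → ∀ φ → eval M φ ≡ eval N φ
  theoryOf-complete N M M⊨Th φ with eval N φ in N⟦φ⟧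
  ... | true  = M⊨Th φ N⟦φ⟧
  ... | false = not-injective (M⊨Th (¬ᶠ φ) (cong not N⟦φ⟧))

  shift : (Atom → Bool) → Model → Model
  shift S A = record { atomVal = S ; kVal = eval A }

  shift-theoryOf-isCanonical : ∀ S N → IsCanonical (theoryOf N) S (shift S N)
  shift-theoryOf-isCanonical S N = (λ _ → refl) , λ φ →
    (λ N⊨φ M M⊨Th → trans (theoryOf-complete N M M⊨Th φ) N⊨φ) ,
    (λ Th⊩φ → Th⊩φ N (λ _ N⊨ψ → N⊨ψ))

  shift-⊨-𝐕 : ∀ S A → shift S A ⊨ᵀ 𝐕
  shift-⊨-𝐕 S A _ (φ , refl , valid) = valid A

  shift-⊨-𝐊 : ∀ S A → shift S A ⊨ᵀ 𝐊
  shift-⊨-𝐊 S A _ (φ , ψ , refl) with eval A φ | eval A ψ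
  ... | true  | true  = refl
  ... | true  | false = refl
  ... | false | _     = refl

  shift-⊨-𝐊𝐊 : ∀ S A → (∀ φ → A ⊨ φ → A ⊨ K φ) → shift S A ⊨ᵀ 𝐊𝐊
  shift-⊨-𝐊𝐊 S A introspective _ (φ , refl) with eval A φ in A⟦φ⟧
  ... | false = refl
  ... | true rewrite introspective φ A⟦φ⟧ = refl

  counterexample⇒¬Generic : ∀ {T T' S M φ} → T ⊆ T' → IsCanonical T' S M →
                            T φ → ¬ M ⊨ φ → ¬ Generic T
  counterexample⇒¬Generic T⊆T' canonical φ∈T M⊭φ generic =
    M⊭φ (generic _ _ T⊆T' _ canonical _ φ∈T)

corollary22 : (Atom : Set) → Atom →
    let open Logic Atom in
    ¬ Generic (𝐕 ∪ 𝐊𝐊) × ¬ Generic (𝐊 ∪ 𝐊𝐊)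
corollary22 Atom p =
  refuted (⊨ᵀ-∪ (shift-⊨-𝐕 _ A) N⊨𝐊𝐊) (inj₂ KKp) ,
  refuted (⊨ᵀ-∪ (shift-⊨-𝐊 _ A) N⊨𝐊𝐊) (inj₂ KKp)
  where
  open Logic Atom

  A N : Model
  A = record { atomVal = const false ; kVal = const true }
  N = shift (const true) A

  N⊨𝐊𝐊 : N ⊨ᵀ 𝐊𝐊
  N⊨𝐊𝐊 = shift-⊨-𝐊𝐊 _ A (λ _ _ → refl)

  KKp : 𝐊𝐊 (K (atom p) ⇒ K (K (atom p)))
  KKp = atom p , refl

  refuted : ∀ {T} → T ⊆ theoryOf N → T (K (atom p) ⇒ K (K (atom p))) → ¬ Generic T
  refuted T⊆Th φ∈T = counterexample⇒¬Generic T⊆Th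
    (shift-theoryOf-isCanonical (const true) N) φ∈T (λ ())
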